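{- Let $G=(V,E)$ be a connected graph with positive integer edge lengths whose shortest-path metric $d$ has doubling dimension $\alpha$, let $r\in V$ be the root, $g\in V$ the (unknown) goal, and $f:V\to\mathbb{Z}$ the (known) predictions. Define $\varphi_1(v)=\sum_{u\in V}|f(u)-d(u,v)|$. Consider the following planning algorithm: for rounds $\rho=0,1,2,\dots$ until $g$ is found, let $S_\rho=\{v\in V\mid\varphi_1(v)<2^\rho\}\setminus(S_0\cup\dots\cup S_{\rho-1})$; if $S_\rho\neq\emptyset$, let $C_\rho$ be a minimum-length Steiner tree on $S_\rho$, move to an arbitrary vertex $r_\rho\in S_\rho$, visit all vertices of $C_\rho$ by an Euler tour of $C_\rho$ (of cost at most twice the length of $C_\rho$), and return to $r_\rho$; otherwise do nothing in this round. Then the total movement cost incurred until the goal $g$ is visited is at most $d(r,g)+2^{O(\alpha)}\cdot O(\varphi_1(g))$.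
   Context: Planning setting: the graph, root, and all predictions are known in advance; the agent starts at $r$, moves between vertices paying the shortest-path distance, and recognizes the goal only upon visiting it. The doubling dimension of a metric is the smallest $\alpha$ such that every ball of radius $2R$ can be covered by at most $2^\alpha$ balls of radius $R$. The quantity $\varphi_1(g)$ is the $\ell_1$ prediction error $\sum_u|f(u)-d(u,g)|$. -}

module Defs where

open import Data.Nat using (ℕ; zero; suc; _+_; _*_; _^_; _≤_; _<_)
open import Data.Integer as ℤ using (ℤ; +_; ∣_∣)
open import Data.Fin using (Fin; _≟_)
open import Data.Nat.ListAction using (sum)
open import Data.List using (List; []; _∷_; map; allFin; concat; upTo; length; last)
open import Data.List.Membership.Propositional using (_∈_)
open import Data.List.Relation.Unary.All using (All)
open import Data.Maybe using (just)
open import Data.Product using (Σ; _×_; _,_; ∃; ∃-syntax)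
open import Data.Sum using (_⊎_)
open import Data.Empty using (⊥)
open import Relation.Nullary using (¬_; yes; no)
open import Relation.Binary.PropositionalEquality using (_≡_)

Edge : ℕ → Set
Edge n = Fin n × Fin n × ℕ

PositiveLengths : ∀ {n} → List (Edge n) → Set
PositiveLengths E = All (λ e → 1 ≤ Data.Product.proj₂ (Data.Product.proj₂ e)) E

Adj : ∀ {n} → List (Edge n) → Fin n → Fin n → ℕ → Set
Adj E u w ℓ = ((u , w , ℓ) ∈ E) ⊎ ((w , u , ℓ) ∈ E)

data WalkLen {n} (E : List (Edge n)) : Fin n → Fin n → ℕ → Set where
  nil  : ∀ {u} → WalkLen E u u 0
  cons : ∀ {u w v ℓ L} → Adj E u w ℓ → WalkLen E w v L → WalkLen E u v (ℓ + L)

-- d is the shortest-path metric of the graph E (this also forces connectivity).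
IsShortestPathMetric : ∀ {n} → List (Edge n) → (Fin n → Fin n → ℕ) → Set
IsShortestPathMetric E d =
  ∀ u v → WalkLen E u v (d u v) × (∀ L → WalkLen E u v L → d u v ≤ L)

-- Since d is integer valued, a ball
-- of real radius 2R equals the ball of radius m = ⌊2R⌋, and a ball of radius
-- R is then {u | 2 · d(c,u) ≤ m}; so quantifying over m : ℕ covers all R ≥ 0.

DoublingCover : ∀ {n} → (Fin n → Fin n → ℕ) → ℕ → Set
DoublingCover {n} d λ′ =
  ∀ (v : Fin n) (m : ℕ) → Σ (List (Fin n)) λ cs → length cs ≤ λ′ ×
    (∀ u → d v u ≤ m → ∃[ c ] (c ∈ cs × 2 * d c u ≤ m))

-- λ′ = 2^α is the doubling constant: the least number of half-radius balls
-- always sufficing.  (α = log₂ λ′, so 2^(c·α) = λ′^c.)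
IsDoublingConstant : ∀ {n} → (Fin n → Fin n → ℕ) → ℕ → Set
IsDoublingConstant d λ′ = DoublingCover d λ′ × (∀ μ → DoublingCover d μ → λ′ ≤ μ)

φ₁ : ∀ {n} → (Fin n → Fin n → ℕ) → (Fin n → ℤ) → Fin n → ℕ
φ₁ {n} d f v = sum (map (λ u → ∣ f u ℤ.- + d u v ∣) (allFin n))

mutual
  InUnion : ∀ {n} → (Fin n → Fin n → ℕ) → (Fin n → ℤ) → ℕ → Fin n → Set
  InUnion d f zero    v = ⊥
  InUnion d f (suc ρ) v = InUnion d f ρ v ⊎ InS d f ρ v

  InS : ∀ {n} → (Fin n → Fin n → ℕ) → (Fin n → ℤ) → ℕ → Fin n → Set
  InS d f ρ v = φ₁ d f v < 2 ^ ρ × ¬ InUnion d f ρ v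

data Reach {n} (T : List (Edge n)) : Fin n → Fin n → Set where
  here : ∀ {u} → Reach T u u
  step : ∀ {u w v ℓ} → Adj T u w ℓ → Reach T w v → Reach T u v

edgesLength : ∀ {n} → List (Edge n) → ℕ
edgesLength T = sum (map (λ e → Data.Product.proj₂ (Data.Product.proj₂ e)) T)

SteinerSubgraph : ∀ {n} → List (Edge n) → (Fin n → Set) → List (Edge n) → Set
SteinerSubgraph E S T =
  All (_∈ E) T × (∀ u v → S u → S v → Reach T u v)

-- A minimum-length Steiner tree on S (with positive lengths a minimum-length
-- connecting subgraph is automatically a tree).
IsMinSteinerTree : ∀ {n} → List (Edge n) → (Fin n → Set) → List (Edge n) → Set
IsMinSteinerTree E S T =
  SteinerSubgraph E S T × (∀ T′ → SteinerSubgraph E S T′ → edgesLength T ≤ edgesLength T′)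

InTree : ∀ {n} → (Fin n → Set) → List (Edge n) → Fin n → Set
InTree S T v = S v ⊎ ∃[ w ] ∃[ ℓ ] Adj T v w ℓ

walkCost : ∀ {n} → (Fin n → Fin n → ℕ) → Fin n → List (Fin n) → ℕ
walkCost d x []       = 0
walkCost d x (y ∷ ys) = d x y + walkCost d y ys

costUntil : ∀ {n} → (Fin n → Fin n → ℕ) → Fin n → Fin n → List (Fin n) → ℕ
costUntil d g x []       = 0
costUntil d g x (y ∷ ys) with y ≟ g
... | yes _ = d x y
... | no  _ = d x y + costUntil d g y ys

costToGoal : ∀ {n} → (Fin n → Fin n → ℕ) → Fin n → Fin n → List (Fin n) → ℕ
costToGoal d g r xs with r ≟ g
... | yes _ = 0
... | no  _ = costUntil d g r xs

-- One round ρ of the planning algorithm.  `plan` is the list of vertices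
-- the agent moves to during round ρ, in order.
--  * If S_ρ = ∅ : nothing happens.
--  * Otherwise : for some minimum Steiner tree C_ρ on S_ρ and some r_ρ ∈ S_ρ,
--    plan = r_ρ ∷ tour, where the agent moves to r_ρ and then performs a
--    closed tour from r_ρ back to r_ρ visiting every vertex of C_ρ, of cost
--    at most 2 · length(C_ρ) (as an Euler tour of C_ρ does).

ValidRound : ∀ {n} → List (Edge n) → (Fin n → Fin n → ℕ) → (Fin n → ℤ) →
             ℕ → List (Fin n) → Set
ValidRound E d f ρ plan =
  ((¬ (∃[ v ] InS d f ρ v)) → plan ≡ []) ×
  ((∃[ v ] InS d f ρ v) →
     ∃[ C ] ∃[ rρ ] ∃[ tour ]
       ( IsMinSteinerTree E (InS d f ρ) C
       × InS d f ρ rρ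
       × plan ≡ rρ ∷ tour
       × last (rρ ∷ tour) ≡ just rρ
       × (∀ v → InTree (InS d f ρ) C v → v ∈ (rρ ∷ tour))
       × walkCost d rρ tour ≤ 2 * edgesLength C))

trajectory : ∀ {n} → (ℕ → List (Fin n)) → ℕ → List (Fin n)
trajectory plans K = concat (map plans (upTo K))

-- A round ρ costs at most 4 Σ_{v ∈ S_ρ} d(g,v): walking to r_ρ costs at most d(·,g) + d(g,r_ρ),
-- the star of shortest paths from g to S_ρ is a Steiner subgraph, so the tour costs at most twice
-- that sum, and the round ends at r_ρ.  Rounds completed before g is found contain only vertices
-- with φ₁(v) ≤ 2 φ₁(g), whence Σ_u |d(u,g) − d(u,v)| ≤ φ₁(g) + φ₁(v) ≤ 3 φ₁(g) =: M.  In a doubling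
-- metric such vertices lie at total distance at most (1 + 8 λ⁵) M from g.  Let D be the largest of
-- these distances, attained at v*.  A vertex u with d(g,u) ≤ D/4 has d(g,u) ≤ |d(u,g) − d(u,v*)|,
-- which sums to at most M; the others lie in λ⁵ balls of radius D/32, and in each ball every u has
-- d(g,u) ≤ D ≤ 8 |d(u,g) − d(u,v)| for a fixed far v in that ball, which sums to at most 8M.
module Submission where

open import Defs
open import Data.Nat using (ℕ; _+_; _*_; _^_; _≤_)
open import Data.Integer using (ℤ)
open import Data.Fin using (Fin)
open import Data.List using (List)
open import Data.Product using (∃-syntax)

open import Data.Empty using (⊥-elim)
open import Data.Fin using (_≟_)
open import Data.Fin.Properties using (any?)
import Data.Integer as Int
import Data.Integer.Properties as Int
import Data.Integer.Tactic.RingSolver as IntSolver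
open import Data.List using ([]; _∷_; _++_; map; concatMap; allFin; length; upTo; last)
open import Data.List.Membership.Propositional using (_∈_)
open import Data.List.Membership.Propositional.Properties
  using (∈-allFin; ∈-++⁺ˡ; ∈-++⁺ʳ; ∈-concat⁺′; ∈-map⁺)
open import Data.List.Properties using (length-++; concatMap-++; upTo-∷ʳ; ++-identityʳ; map-++; map-cong)
open import Data.List.Relation.Unary.All as All using (All)
open import Data.List.Relation.Unary.All.Properties using (concat⁺; map⁺)
open import Data.List.Relation.Unary.Any using (here; there)
open import Data.Maybe using (just)
open import Data.Maybe.Properties using (just-injective)
open import Data.Nat using (zero; suc; _<_; _∸_; z≤n; s≤s; _≤?_; _<?_; ∣_-_∣; ⌊_/2⌋; ⌈_/2⌉; NonZero; >-nonZero)
open import Data.Nat.ListAction using (sum)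
open import Data.Nat.ListAction.Properties using (sum-++)
open import Data.Nat.Properties hiding (_≟_)
open import Data.Nat.Tactic.RingSolver using (solve)
open import Data.Product using (Σ; _×_; _,_; proj₁; proj₂)
open import Data.Sum using (_⊎_; inj₁; inj₂)
open import Algebra.Properties.CommutativeSemigroup +-commutativeSemigroup using (interchange)
open import Data.List.Extrema ≤-totalOrder using (argmax; f[xs]≤f[argmax])
open import Function.Metric.Nat using (Symmetric; TriangleInequality)
open import Relation.Nullary using (¬_; Dec; yes; no)
open import Relation.Nullary.Decidable using (_×-dec_; _⊎-dec_; ¬?)
open import Relation.Binary.PropositionalEquality using (_≡_; refl; sym; trans; cong; subst; module ≡-Reasoning)

module _ {A : Set} where

  sum-map-+ : ∀ (a b : A → ℕ) xs →
              sum (map (λ x → a x + b x) xs) ≡ sum (map a xs) + sum (map b xs)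
  sum-map-+ a b []       = refl
  sum-map-+ a b (x ∷ xs) = trans (cong (a x + b x +_) (sum-map-+ a b xs))
                                 (interchange (a x) (b x) (sum (map a xs)) (sum (map b xs)))

  sum-map-*ˡ : ∀ k (a : A → ℕ) xs → sum (map (λ x → k * a x) xs) ≡ k * sum (map a xs)
  sum-map-*ˡ k a []       = sym (*-zeroʳ k)
  sum-map-*ˡ k a (x ∷ xs) = trans (cong (k * a x +_) (sum-map-*ˡ k a xs))
                                  (sym (*-distribˡ-+ k (a x) (sum (map a xs))))

  sum-map-mono : ∀ {a b : A → ℕ} xs → (∀ x → a x ≤ b x) → sum (map a xs) ≤ sum (map b xs)
  sum-map-mono []       a≤b = z≤n
  sum-map-mono (x ∷ xs) a≤b = +-mono-≤ (a≤b x) (sum-map-mono xs a≤b)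

  sum-map-zero : ∀ {a : A → ℕ} xs → (∀ x → a x ≡ 0) → sum (map a xs) ≡ 0
  sum-map-zero     []       a≡0 = refl
  sum-map-zero {a} (x ∷ xs) a≡0 = trans (cong (_+ sum (map a xs)) (a≡0 x)) (sum-map-zero xs a≡0)

  sum-map-≤-length* : ∀ {a : A → ℕ} {B} xs → (∀ x → a x ≤ B) → sum (map a xs) ≤ length xs * B
  sum-map-≤-length* []       a≤B = z≤n
  sum-map-≤-length* (x ∷ xs) a≤B = +-mono-≤ (a≤B x) (sum-map-≤-length* xs a≤B)

  ∈⇒≤sum-map : ∀ (a : A → ℕ) {x xs} → x ∈ xs → a x ≤ sum (map a xs)
  ∈⇒≤sum-map a {xs = y ∷ ys} (here refl) = m≤m+n (a y) _
  ∈⇒≤sum-map a {xs = y ∷ ys} (there x∈) = ≤-trans (∈⇒≤sum-map a x∈) (m≤n+m _ (a y))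

sum-map-swap : ∀ {A C : Set} (F : C → A → ℕ) (cs : List C) (xs : List A) →
               sum (map (λ x → sum (map (λ c → F c x) cs)) xs) ≡ sum (map (λ c → sum (map (F c) xs)) cs)
sum-map-swap F []       xs = sum-map-zero xs (λ _ → refl)
sum-map-swap F (c ∷ cs) xs = trans (sum-map-+ (F c) (λ x → sum (map (λ c → F c x) cs)) xs)
                                   (cong (sum (map (F c) xs) +_) (sum-map-swap F cs xs))

length-concatMap-≤ : ∀ {A B : Set} (F : A → List B) {k} xs → (∀ x → length (F x) ≤ k) →
                     length (concatMap F xs) ≤ length xs * k
length-concatMap-≤ F []       lenF≤k = z≤n
length-concatMap-≤ F (x ∷ xs) lenF≤k rewrite length-++ (F x) {concatMap F xs} =
  +-mono-≤ (lenF≤k x) (length-concatMap-≤ F xs lenF≤k)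

∑ : ∀ {n} → (Fin n → ℕ) → ℕ
∑ {n} h = sum (map h (allFin n))

∑-mono : ∀ {n} {a b : Fin n → ℕ} → (∀ x → a x ≤ b x) → ∑ a ≤ ∑ b
∑-mono {n} = sum-map-mono (allFin n)

private variable P Q R : Set

select : Dec P → ℕ → ℕ
select (yes _) x = x
select (no _)  x = 0

select-yes : ∀ (P? : Dec P) {x} → P → select P? x ≡ x
select-yes (yes _) p = refl
select-yes (no ¬p) p = ⊥-elim (¬p p)

select-no : ∀ (P? : Dec P) {x} → ¬ P → select P? x ≡ 0
select-no (yes p) ¬p = ⊥-elim (¬p p)
select-no (no _)  ¬p = refl

select-≤ : ∀ (P? : Dec P) {x y} → (P → x ≤ y) → select P? x ≤ y
select-≤ (yes p) x≤y = x≤y p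
select-≤ (no _)  x≤y = z≤n

select-mono : ∀ (P? : Dec P) (Q? : Dec Q) {x} → (P → Q) → select P? x ≤ select Q? x
select-mono P? Q? P⇒Q = select-≤ P? (λ p → ≤-reflexive (sym (select-yes Q? (P⇒Q p))))

select-⊎ : ∀ (P? : Dec P) (Q? : Dec Q) (R? : Dec R) {x} → (P → Q ⊎ R) →
           select P? x ≤ select Q? x + select R? x
select-⊎ P? Q? R? {x} P⇒Q⊎R = select-≤ P? λ p → case (P⇒Q⊎R p)
  where
  case : _ ⊎ _ → x ≤ select Q? x + select R? x
  case (inj₁ q) = ≤-trans (≤-reflexive (sym (select-yes Q? q))) (m≤m+n _ _)
  case (inj₂ r) = ≤-trans (≤-reflexive (sym (select-yes R? r))) (m≤n+m _ _)

select-disjoint-+ : ∀ (P? : Dec P) (Q? : Dec Q) (R? : Dec R) {x} →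
                    (P → R) → (Q → R) → (Q → ¬ P) → select P? x + select Q? x ≤ select R? x
select-disjoint-+ (yes p) (yes q) R? P⇒R Q⇒R Q⇒¬P = ⊥-elim (Q⇒¬P q p)
select-disjoint-+ (yes p) (no _)  R? P⇒R Q⇒R Q⇒¬P =
  ≤-reflexive (trans (+-identityʳ _) (sym (select-yes R? (P⇒R p))))
select-disjoint-+ (no _)  (yes q) R? P⇒R Q⇒R Q⇒¬P = ≤-reflexive (sym (select-yes R? (Q⇒R q)))
select-disjoint-+ (no _)  (no _)  R? P⇒R Q⇒R Q⇒¬P = z≤n

≤∑-select : ∀ {n} {P : Fin n → Set} (P? : ∀ v → Dec (P v)) (h : Fin n → ℕ) {v} →
            P v → h v ≤ ∑ (λ u → select (P? u) (h u))
≤∑-select P? h {v} p = ≤-trans (≤-reflexive (sym (select-yes (P? v) p)))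
                                 (∈⇒≤sum-map (λ u → select (P? u) (h u)) (∈-allFin v))

-- Walks, reachability and the shortest-path metric

Adj-sym : ∀ {n} {T : List (Edge n)} {u w ℓ} → Adj T u w ℓ → Adj T w u ℓ
Adj-sym (inj₁ e) = inj₂ e
Adj-sym (inj₂ e) = inj₁ e

module _ {n} {T : List (Edge n)} where

  Reach-trans : ∀ {u w v} → Reach T u w → Reach T w v → Reach T u v
  Reach-trans here       q = q
  Reach-trans (step a p) q = step a (Reach-trans p q)

  Reach-sym : ∀ {u v} → Reach T u v → Reach T v u
  Reach-sym here       = here
  Reach-sym (step a p) = Reach-trans (Reach-sym p) (step (Adj-sym a) here)

  Reach-mono : ∀ {T′} → (∀ {e} → e ∈ T → e ∈ T′) → ∀ {u v} → Reach T u v → Reach T′ u v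
  Reach-mono T⊆T′ here                = here
  Reach-mono T⊆T′ (step (inj₁ e∈) p) = step (inj₁ (T⊆T′ e∈)) (Reach-mono T⊆T′ p)
  Reach-mono T⊆T′ (step (inj₂ e∈) p) = step (inj₂ (T⊆T′ e∈)) (Reach-mono T⊆T′ p)

edgesLength-++ : ∀ {n} (T T′ : List (Edge n)) → edgesLength (T ++ T′) ≡ edgesLength T + edgesLength T′
edgesLength-++ {n} T T′ = trans (cong sum (map-++ ℓ T T′)) (sum-++ (map ℓ T) (map ℓ T′))
  where
  ℓ : Edge n → ℕ
  ℓ (_ , _ , l) = l

edgesLength-concatMap : ∀ {n} {A : Set} (F : A → List (Edge n)) xs →
                        edgesLength (concatMap F xs) ≡ sum (map (λ x → edgesLength (F x)) xs)
edgesLength-concatMap F []       = refl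
edgesLength-concatMap F (x ∷ xs) = trans (edgesLength-++ (F x) (concatMap F xs))
                                         (cong (edgesLength (F x) +_) (edgesLength-concatMap F xs))

module Walks {n} (E : List (Edge n)) where

  walk-++ : ∀ {u w v L₁ L₂} → WalkLen E u w L₁ → WalkLen E w v L₂ → WalkLen E u v (L₁ + L₂)
  walk-++ nil                        q = q
  walk-++ (cons {ℓ = ℓ} {L = L} a p) q = subst (WalkLen E _ _) (sym (+-assoc ℓ L _)) (cons a (walk-++ p q))

  walk-reverse : ∀ {u v L} → WalkLen E u v L → WalkLen E v u L
  walk-reverse nil                        = nil
  walk-reverse (cons {ℓ = ℓ} {L = L} a p) =
    subst (WalkLen E _ _) (trans (cong (L +_) (+-identityʳ ℓ)) (+-comm L ℓ))
          (walk-++ (walk-reverse p) (cons (Adj-sym a) nil))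

  walkEdges : ∀ {u v L} → WalkLen E u v L → List (Edge n)
  walkEdges nil                               = []
  walkEdges (cons {u} {w} {ℓ = ℓ} (inj₁ _) p) = (u , w , ℓ) ∷ walkEdges p
  walkEdges (cons {u} {w} {ℓ = ℓ} (inj₂ _) p) = (w , u , ℓ) ∷ walkEdges p

  edgesLength-walkEdges : ∀ {u v L} (p : WalkLen E u v L) → edgesLength (walkEdges p) ≡ L
  edgesLength-walkEdges nil               = refl
  edgesLength-walkEdges (cons (inj₁ _) p) = cong (_ +_) (edgesLength-walkEdges p)
  edgesLength-walkEdges (cons (inj₂ _) p) = cong (_ +_) (edgesLength-walkEdges p)

  walkEdges⊆E : ∀ {u v L} (p : WalkLen E u v L) → All (_∈ E) (walkEdges p)
  walkEdges⊆E nil                = All.[]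
  walkEdges⊆E (cons (inj₁ e∈) p) = e∈ All.∷ walkEdges⊆E p
  walkEdges⊆E (cons (inj₂ e∈) p) = e∈ All.∷ walkEdges⊆E p

  walk⇒Reach : ∀ {u v L} (p : WalkLen E u v L) → Reach (walkEdges p) u v
  walk⇒Reach nil               = here
  walk⇒Reach (cons (inj₁ _) p) = step (inj₁ (here refl)) (Reach-mono there (walk⇒Reach p))
  walk⇒Reach (cons (inj₂ _) p) = step (inj₂ (here refl)) (Reach-mono there (walk⇒Reach p))

module ShortestPathMetric {n} {E : List (Edge n)} {d : Fin n → Fin n → ℕ}
                          (isSP : IsShortestPathMetric E d) where
  open Walks E

  shortestWalk : ∀ u v → WalkLen E u v (d u v)
  shortestWalk u v = proj₁ (isSP u v)

  d≤walk : ∀ {u v L} → WalkLen E u v L → d u v ≤ L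
  d≤walk {u} {v} = proj₂ (isSP u v) _

  d-refl : ∀ u → d u u ≡ 0
  d-refl u = n≤0⇒n≡0 (d≤walk nil)

  d-sym : Symmetric d
  d-sym u v = ≤-antisym (d≤walk (walk-reverse (shortestWalk v u)))
                        (d≤walk (walk-reverse (shortestWalk u v)))

  d-triangle : TriangleInequality d
  d-triangle u v w = d≤walk (walk-++ (shortestWalk u v) (shortestWalk v w))

  -- The star of shortest paths from x to the terminals is a Steiner subgraph.
  minSteinerTree≤star : ∀ {S : Fin n → Set} (S? : ∀ v → Dec (S v)) x {C} → IsMinSteinerTree E S C →
                        edgesLength C ≤ ∑ (λ v → select (S? v) (d x v))
  minSteinerTree≤star {S} S? x (_ , minimal) =
    subst (_ ≤_) star-length (minimal star (All.tabulate star⊆E , connects))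
    where
    spoke : ∀ {v} → Dec (S v) → List (Edge n)
    spoke {v} (yes _) = walkEdges (shortestWalk x v)
    spoke     (no _)  = []

    star : List (Edge n)
    star = concatMap (λ v → spoke (S? v)) (allFin n)

    star-length : edgesLength star ≡ ∑ (λ v → select (S? v) (d x v))
    star-length = trans (edgesLength-concatMap _ (allFin n)) (cong sum (map-cong spoke-length (allFin n)))
      where
      spoke-length : ∀ v → edgesLength (spoke (S? v)) ≡ select (S? v) (d x v)
      spoke-length v with S? v
      ... | yes _ = edgesLength-walkEdges (shortestWalk x v)
      ... | no _  = refl

    star⊆E : ∀ {e} → e ∈ star → e ∈ E
    star⊆E = All.lookup (concat⁺ (map⁺ (All.tabulate {xs = allFin n} (λ {v} _ → spoke⊆E v))))
      where
      spoke⊆E : ∀ v → All (_∈ E) (spoke (S? v))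
      spoke⊆E v with S? v
      ... | yes _ = walkEdges⊆E (shortestWalk x v)
      ... | no _  = All.[]

    x⇝ : ∀ v → S v → Reach star x v
    x⇝ v sv = Reach-mono (λ e∈ → ∈-concat⁺′ (onSpoke (S? v) e∈) (∈-map⁺ _ (∈-allFin v)))
                         (walk⇒Reach (shortestWalk x v))
      where
      onSpoke : ∀ (S?v : Dec (S v)) {e} → e ∈ walkEdges (shortestWalk x v) → e ∈ spoke S?v
      onSpoke (yes _) e∈ = e∈
      onSpoke (no ¬sv) _ = ⊥-elim (¬sv sv)

    connects : ∀ u v → S u → S v → Reach star u v
    connects u v su sv = Reach-trans (Reach-sym (x⇝ u su)) (x⇝ v sv)

-- Doubling metrics

2*⌊n/2⌋≤n : ∀ n → 2 * ⌊ n /2⌋ ≤ n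
2*⌊n/2⌋≤n n = begin
  2 * ⌊ n /2⌋           ≡⟨ cong (⌊ n /2⌋ +_) (+-identityʳ ⌊ n /2⌋) ⟩
  ⌊ n /2⌋ + ⌊ n /2⌋     ≤⟨ +-monoʳ-≤ ⌊ n /2⌋ (⌊n/2⌋≤⌈n/2⌉ n) ⟩
  ⌊ n /2⌋ + ⌈ n /2⌉     ≡⟨ ⌊n/2⌋+⌈n/2⌉≡n n ⟩
  n                     ∎
  where open ≤-Reasoning

2*m≤n⇒m≤⌊n/2⌋ : ∀ {m n} → 2 * m ≤ n → m ≤ ⌊ n /2⌋
2*m≤n⇒m≤⌊n/2⌋ {m} {n} 2m≤n = begin
  m                     ≡⟨ n≡⌊n+n/2⌋ m ⟩
  ⌊ m + m /2⌋           ≡⟨ cong (λ k → ⌊ m + k /2⌋) (sym (+-identityʳ m)) ⟩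
  ⌊ 2 * m /2⌋           ≤⟨ ⌊n/2⌋-mono 2m≤n ⟩
  ⌊ n /2⌋               ∎
  where open ≤-Reasoning

BallCover : ∀ {n} → (Fin n → Fin n → ℕ) → ℕ → Fin n → ℕ → List (Fin n) → Set
BallCover d s v m cs = ∀ u → d v u ≤ m → ∃[ c ] (c ∈ cs × s * d c u ≤ m)

iteratedCover : ∀ {n} {d : Fin n → Fin n → ℕ} {λ′} → DoublingCover d λ′ →
                ∀ k v m → Σ (List (Fin n)) λ cs → length cs ≤ λ′ ^ k × BallCover d (2 ^ k) v m cs
iteratedCover cover zero v m =
  v ∷ [] , ≤-refl , λ u dvu≤m → v , here refl , subst (_≤ m) (sym (*-identityˡ _)) dvu≤m
iteratedCover {n} {d} {λ′} cover (suc k) v m =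
  concatMap centres cs₁ ,
  ≤-trans (length-concatMap-≤ centres cs₁ (λ c → proj₁ (proj₂ (finer c))))
          (*-monoˡ-≤ (λ′ ^ k) (proj₁ (proj₂ (cover v m)))) ,
  covers
  where
  cs₁ : List (Fin n)
  cs₁ = proj₁ (cover v m)

  finer : ∀ c → Σ (List (Fin n)) λ cs → length cs ≤ λ′ ^ k × BallCover d (2 ^ k) c ⌊ m /2⌋ cs
  finer c = iteratedCover cover k c ⌊ m /2⌋

  centres : Fin n → List (Fin n)
  centres c = proj₁ (finer c)

  covers : BallCover d (2 ^ suc k) v m (concatMap centres cs₁)
  covers u dvu≤m with proj₂ (proj₂ (cover v m)) u dvu≤m
  ... | c , c∈ , 2dcu≤m with proj₂ (proj₂ (finer c)) u (2*m≤n⇒m≤⌊n/2⌋ 2dcu≤m)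
  ... | c′ , c′∈ , dc′u≤ = c′ , ∈-concat⁺′ c′∈ (∈-map⁺ centres c∈) , (begin
    2 ^ suc k * d c′ u      ≡⟨ *-assoc 2 (2 ^ k) (d c′ u) ⟩
    2 * (2 ^ k * d c′ u)    ≤⟨ *-monoʳ-≤ 2 dc′u≤ ⟩
    2 * ⌊ m /2⌋             ≤⟨ 2*⌊n/2⌋≤n m ⟩
    m                       ∎)
    where open ≤-Reasoning

-- Vertices of small ℓ₁ deviation in a doubling metric

private
  quarter-bound : ∀ a δ → 4 * a ≤ a + (a + δ) → a ≤ δ
  quarter-bound a δ 4a≤ = ≤-trans (m≤m+n a a) (+-cancelˡ-≤ (a + a) (a + a) δ (begin
    (a + a) + (a + a)   ≡⟨ solve (a ∷ []) ⟩
    4 * a               ≤⟨ 4a≤ ⟩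
    a + (a + δ)         ≡⟨ +-assoc a a δ ⟨
    (a + a) + δ         ∎))
    where open ≤-Reasoning

  eighth-bound : ∀ D x y z e δ → D ≤ 4 * e → 32 * y ≤ D → 32 * z ≤ D → x ≤ y + z →
                 e ≤ (x + δ) + x → D ≤ 8 * δ
  eighth-bound D x y z e δ D≤4e 32y≤D 32z≤D x≤y+z e≤ =
    *-cancelˡ-≤ 2 (+-cancelˡ-≤ (2 * D) (2 * D) (2 * (8 * δ)) (begin
      2 * D + 2 * D                   ≡⟨ solve (D ∷ []) ⟩
      4 * D                           ≤⟨ *-monoʳ-≤ 4 D≤4e ⟩
      4 * (4 * e)                     ≡⟨ solve (e ∷ []) ⟩
      16 * e                          ≤⟨ *-monoʳ-≤ 16 e≤ ⟩
      16 * ((x + δ) + x)              ≡⟨ solve (x ∷ δ ∷ []) ⟩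
      32 * x + 2 * (8 * δ)            ≤⟨ +-monoˡ-≤ (2 * (8 * δ)) (*-monoʳ-≤ 32 x≤y+z) ⟩
      32 * (y + z) + 2 * (8 * δ)      ≡⟨ cong (_+ 2 * (8 * δ)) (*-distribˡ-+ 32 y z) ⟩
      (32 * y + 32 * z) + 2 * (8 * δ) ≤⟨ +-monoˡ-≤ (2 * (8 * δ)) (+-mono-≤ 32y≤D 32z≤D) ⟩
      (D + D) + 2 * (8 * δ)           ≡⟨ solve (D ∷ δ ∷ []) ⟩
      2 * D + 2 * (8 * δ)             ∎))
    where open ≤-Reasoning

module _ {n} {d : Fin n → Fin n → ℕ} (d-sym : Symmetric d) (d-tri : TriangleInequality d) where

  near-deviation : ∀ g u v → 4 * d g u ≤ d g v → d g u ≤ ∣ d u g - d u v ∣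
  near-deviation g u v 4dgu≤dgv = quarter-bound (d g u) ∣ d u g - d u v ∣ (begin
    4 * d g u                           ≤⟨ 4dgu≤dgv ⟩
    d g v                               ≤⟨ d-tri g u v ⟩
    d g u + d u v                       ≤⟨ +-monoʳ-≤ (d g u) (m≤n+∣n-m∣ (d u v) (d u g)) ⟩
    d g u + (d u g + ∣ d u g - d u v ∣) ≡⟨ cong (λ t → d g u + (t + ∣ d u g - d u v ∣)) (d-sym u g) ⟩
    d g u + (d g u + ∣ d u g - d u v ∣) ∎)
    where open ≤-Reasoning

  far-deviation : ∀ g u v c {D} → D ≤ 4 * d g v → 32 * d c u ≤ D → 32 * d c v ≤ D →
                  D ≤ 8 * ∣ d u g - d u v ∣
  far-deviation g u v c {D} D≤4dgv 32dcu≤D 32dcv≤D =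
    eighth-bound D (d u v) (d c u) (d c v) (d g v) ∣ d u g - d u v ∣ D≤4dgv 32dcu≤D 32dcv≤D duv≤ dgv≤
    where
    open ≤-Reasoning
    duv≤ : d u v ≤ d c u + d c v
    duv≤ = subst (λ t → d u v ≤ t + d c v) (d-sym u c) (d-tri u c v)
    dgv≤ : d g v ≤ (d u v + ∣ d u g - d u v ∣) + d u v
    dgv≤ = begin
      d g v                               ≤⟨ d-tri g u v ⟩
      d g u + d u v                       ≡⟨ cong (_+ d u v) (d-sym g u) ⟩
      d u g + d u v                       ≤⟨ +-monoˡ-≤ (d u v) (m≤n+∣m-n∣ (d u g) (d u v)) ⟩
      (d u v + ∣ d u g - d u v ∣) + d u v ∎

  module _ {λ′} (cover : DoublingCover d λ′) (g : Fin n) {W : Fin n → Set} (W? : ∀ v → Dec (W v))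
           (M : ℕ) (deviation≤M : ∀ v → W v → ∑ (λ u → ∣ d u g - d u v ∣) ≤ M) where

    module FromFarthest (v* : Fin n) (Wv* : W v*) (farthest : ∀ u → W u → d g u ≤ d g v*) where

      D : ℕ
      D = d g v*

      Near Far : Fin n → Set
      Near u = W u × 4 * d g u ≤ D
      Far  u = W u × D ≤ 4 * d g u

      Near? : ∀ u → Dec (Near u)
      Near? u = W? u ×-dec (4 * d g u ≤? D)

      Far? : ∀ u → Dec (Far u)
      Far? u = W? u ×-dec (D ≤? 4 * d g u)

      W⇒Near⊎Far : ∀ u → W u → Near u ⊎ Far u
      W⇒Near⊎Far u Wu = Data.Sum.map (Wu ,_) (Wu ,_) (≤-total (4 * d g u) D)

      near-mass≤ : ∑ (λ u → select (Near? u) (d g u)) ≤ M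
      near-mass≤ = ≤-trans (∑-mono λ u → select-≤ (Near? u) λ (_ , near) → near-deviation g u v* near)
                           (deviation≤M v* Wv*)

      centres : List (Fin n)
      centres = proj₁ (iteratedCover cover 5 g D)

      InBall : Fin n → Fin n → Set
      InBall c u = Far u × 32 * d c u ≤ D

      InBall? : ∀ c u → Dec (InBall c u)
      InBall? c u = Far? u ×-dec (32 * d c u ≤? D)

      ball-mass≤ : ∀ c → ∑ (λ u → select (InBall? c u) (d g u)) ≤ 8 * M
      ball-mass≤ c with any? (InBall? c)
      ... | no ∄ =
        ≤-trans (≤-reflexive (sum-map-zero (allFin n) λ u → select-no (InBall? c u) λ b → ∄ (u , b))) z≤n
      ... | yes (v , ((Wv , D≤4dgv) , 32dcv≤D)) = begin
        ∑ (λ u → select (InBall? c u) (d g u)) ≤⟨ ∑-mono inBall≤ ⟩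
        ∑ (λ u → 8 * ∣ d u g - d u v ∣)       ≡⟨ sum-map-*ˡ 8 _ (allFin n) ⟩
        8 * ∑ (λ u → ∣ d u g - d u v ∣)       ≤⟨ *-monoʳ-≤ 8 (deviation≤M v Wv) ⟩
        8 * M                                 ∎
        where
        open ≤-Reasoning
        inBall≤ : ∀ u → select (InBall? c u) (d g u) ≤ 8 * ∣ d u g - d u v ∣
        inBall≤ u = select-≤ (InBall? c u) λ ((Wu , _) , 32dcu≤D) →
          ≤-trans (farthest u Wu) (far-deviation g u v c D≤4dgv 32dcu≤D 32dcv≤D)

      far≤balls : ∀ u → select (Far? u) (d g u) ≤ sum (map (λ c → select (InBall? c u) (d g u)) centres)
      far≤balls u = select-≤ (Far? u) λ far@(Wu , _) →
        let (c , c∈ , 32dcu≤D) = proj₂ (proj₂ (iteratedCover cover 5 g D)) u (farthest u Wu)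
        in ≤-trans (≤-reflexive (sym (select-yes (InBall? c u) (far , 32dcu≤D))))
                   (∈⇒≤sum-map (λ c → select (InBall? c u) (d g u)) c∈)

      far-mass≤ : ∑ (λ u → select (Far? u) (d g u)) ≤ λ′ ^ 5 * (8 * M)
      far-mass≤ = begin
        ∑ (λ u → select (Far? u) (d g u))
          ≤⟨ ∑-mono far≤balls ⟩
        ∑ (λ u → sum (map (λ c → select (InBall? c u) (d g u)) centres))
          ≡⟨ sum-map-swap (λ c u → select (InBall? c u) (d g u)) centres (allFin n) ⟩
        sum (map (λ c → ∑ (λ u → select (InBall? c u) (d g u))) centres)
          ≤⟨ sum-map-≤-length* centres ball-mass≤ ⟩
        length centres * (8 * M)
          ≤⟨ *-monoˡ-≤ (8 * M) (proj₁ (proj₂ (iteratedCover cover 5 g D))) ⟩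
        λ′ ^ 5 * (8 * M)
          ∎
        where open ≤-Reasoning

      mass≤ : ∑ (λ v → select (W? v) (d g v)) ≤ M + λ′ ^ 5 * (8 * M)
      mass≤ = begin
        ∑ (λ v → select (W? v) (d g v))
          ≤⟨ ∑-mono (λ u → select-⊎ (W? u) (Near? u) (Far? u) (W⇒Near⊎Far u)) ⟩
        ∑ (λ u → select (Near? u) (d g u) + select (Far? u) (d g u))
          ≡⟨ sum-map-+ _ _ (allFin n) ⟩
        ∑ (λ u → select (Near? u) (d g u)) + ∑ (λ u → select (Far? u) (d g u))
          ≤⟨ +-mono-≤ near-mass≤ far-mass≤ ⟩
        M + λ′ ^ 5 * (8 * M)
          ∎
        where open ≤-Reasoning

    totalDistance≤ : ∑ (λ v → select (W? v) (d g v)) ≤ M + λ′ ^ 5 * (8 * M)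
    totalDistance≤ = fromArgmax (argmax distW g (allFin n))
                                (λ u → All.lookup (f[xs]≤f[argmax] g (allFin n)) (∈-allFin u))
      where
      distW : Fin n → ℕ
      distW v = select (W? v) (d g v)

      fromArgmax : ∀ v* → (∀ u → distW u ≤ distW v*) → ∑ distW ≤ M + λ′ ^ 5 * (8 * M)
      fromArgmax v* maximal with W? v*
      ... | yes Wv* = FromFarthest.mass≤ v* Wv* λ u Wu →
                        subst (_≤ d g v*) (select-yes (W? u) Wu) (maximal u)
      ... | no _    = ≤-trans (≤-reflexive (sum-map-zero (allFin n) (λ u → n≤0⇒n≡0 (maximal u)))) z≤n

∣+m-+n∣≡∣m-n∣ : ∀ m n → Int.∣ Int.+ m Int.- Int.+ n ∣ ≡ ∣ m - n ∣
∣+m-+n∣≡∣m-n∣ m n with ≤-total m n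
... | inj₁ m≤n = begin
  Int.∣ Int.+ m Int.- Int.+ n ∣ ≡⟨ cong Int.∣_∣ (Int.[+m]-[+n]≡m⊖n m n) ⟩
  Int.∣ m Int.⊖ n ∣             ≡⟨ Int.∣⊖∣-≤ m≤n ⟩
  n ∸ m                         ≡⟨ m≤n⇒∣m-n∣≡n∸m m≤n ⟨
  ∣ m - n ∣                     ∎
  where open ≡-Reasoning
... | inj₂ n≤m = begin
  Int.∣ Int.+ m Int.- Int.+ n ∣ ≡⟨ cong Int.∣_∣ (Int.[+m]-[+n]≡m⊖n m n) ⟩
  Int.∣ m Int.⊖ n ∣             ≡⟨ Int.∣m⊖n∣≡∣n⊖m∣ m n ⟩
  Int.∣ n Int.⊖ m ∣             ≡⟨ Int.∣⊖∣-≤ n≤m ⟩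
  m ∸ n                         ≡⟨ m≤n⇒∣n-m∣≡n∸m n≤m ⟨
  ∣ m - n ∣                     ∎
  where open ≡-Reasoning

deviation≤φ₁+φ₁ : ∀ {n} (d : Fin n → Fin n → ℕ) (f : Fin n → ℤ) g v →
                  ∑ (λ u → ∣ d u g - d u v ∣) ≤ φ₁ d f g + φ₁ d f v
deviation≤φ₁+φ₁ {n} d f g v =
  ≤-trans (∑-mono pointwise) (≤-reflexive (sum-map-+ (error g) (error v) (allFin n)))
  where
  error : Fin n → Fin n → ℕ
  error w u = Int.∣ f u Int.- Int.+ d u w ∣

  difference : ∀ x i j → i Int.- j ≡ (x Int.- j) Int.- (x Int.- i)
  difference = IntSolver.solve-∀

  pointwise : ∀ u → ∣ d u g - d u v ∣ ≤ error g u + error v u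
  pointwise u = begin
    ∣ d u g - d u v ∣
      ≡⟨ ∣+m-+n∣≡∣m-n∣ (d u g) (d u v) ⟨
    Int.∣ Int.+ d u g Int.- Int.+ d u v ∣
      ≡⟨ cong Int.∣_∣ (difference (f u) (Int.+ d u g) (Int.+ d u v)) ⟩
    Int.∣ (f u Int.- Int.+ d u v) Int.- (f u Int.- Int.+ d u g) ∣
      ≤⟨ Int.∣i-j∣≤∣i∣+∣j∣ (f u Int.- Int.+ d u v) (f u Int.- Int.+ d u g) ⟩
    error v u + error g u
      ≡⟨ +-comm (error v u) (error g u) ⟩
    error g u + error v u
      ∎
    where open ≤-Reasoning

module _ {n} (d : Fin n → Fin n → ℕ) (f : Fin n → ℤ) where

  mutual
    InUnion? : ∀ ρ v → Dec (InUnion d f ρ v)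
    InUnion? zero    v = no λ ()
    InUnion? (suc ρ) v = InUnion? ρ v ⊎-dec InS? ρ v

    InS? : ∀ ρ v → Dec (InS d f ρ v)
    InS? ρ v = (φ₁ d f v <? 2 ^ ρ) ×-dec ¬? (InUnion? ρ v)

  InUnion⇒φ₁< : ∀ k {v} → InUnion d f (suc k) v → φ₁ d f v < 2 ^ k
  InUnion⇒φ₁< zero    (inj₂ v∈S)  = proj₁ v∈S
  InUnion⇒φ₁< (suc k) (inj₁ v∈U) = <-≤-trans (InUnion⇒φ₁< k v∈U) (m≤m+n (2 ^ k) _)
  InUnion⇒φ₁< (suc k) (inj₂ v∈S) = proj₁ v∈S

  ∉InUnion⇒φ₁≥ : ∀ k {v} → ¬ InUnion d f (suc k) v → 2 ^ k ≤ φ₁ d f v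
  ∉InUnion⇒φ₁≥ k v∉ = ≮⇒≥ λ φ<2ᵏ → v∉ (inj₂ (φ<2ᵏ , λ v∈U → v∉ (inj₁ v∈U)))

  InUnion-suc⇒φ₁≤2*φ₁ : ∀ K {v w} → ¬ InUnion d f K w → InUnion d f (suc K) v →
                        φ₁ d f v ≤ 2 * φ₁ d f w
  InUnion-suc⇒φ₁≤2*φ₁ zero    w∉ v∈ = ≤-trans (≤-pred (InUnion⇒φ₁< 0 v∈)) z≤n
  InUnion-suc⇒φ₁≤2*φ₁ (suc k) w∉ v∈ =
    ≤-trans (<⇒≤ (InUnion⇒φ₁< (suc k) v∈)) (*-monoʳ-≤ 2 (∉InUnion⇒φ₁≥ k w∉))

lastOr : ∀ {A : Set} → A → List A → A
lastOr x []       = x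
lastOr x (y ∷ ys) = lastOr y ys

lastOr-++ : ∀ {A : Set} (x : A) xs ys → lastOr x (xs ++ ys) ≡ lastOr (lastOr x xs) ys
lastOr-++ x []       ys = refl
lastOr-++ x (y ∷ xs) ys = lastOr-++ y xs ys

lastOr-last : ∀ {A : Set} (x : A) xs {z} → last (x ∷ xs) ≡ just z → lastOr x xs ≡ z
lastOr-last x []       last≡ = just-injective last≡
lastOr-last x (y ∷ xs) last≡ = lastOr-last y xs last≡

trajectory-suc : ∀ {n} (plans : ℕ → List (Fin n)) K →
                 trajectory plans (suc K) ≡ trajectory plans K ++ plans K
trajectory-suc plans K = begin
  concatMap plans (upTo (suc K))              ≡⟨ cong (concatMap plans) (upTo-∷ʳ K) ⟨
  concatMap plans (upTo K ++ K ∷ [])          ≡⟨ concatMap-++ plans (upTo K) (K ∷ []) ⟩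
  concatMap plans (upTo K) ++ (plans K ++ []) ≡⟨ cong (concatMap plans (upTo K) ++_) (++-identityʳ (plans K)) ⟩
  concatMap plans (upTo K) ++ plans K         ∎
  where open ≡-Reasoning

module _ {n} (d : Fin n → Fin n → ℕ) where

  walkCost-++ : ∀ x xs ys → walkCost d x (xs ++ ys) ≡ walkCost d x xs + walkCost d (lastOr x xs) ys
  walkCost-++ x []       ys = refl
  walkCost-++ x (y ∷ xs) ys = trans (cong (d x y +_) (walkCost-++ y xs ys)) (sym (+-assoc (d x y) _ _))

  module _ (g : Fin n) where

    costUntil≤walkCost : ∀ x xs → costUntil d g x xs ≤ walkCost d x xs
    costUntil≤walkCost x []       = z≤n
    costUntil≤walkCost x (y ∷ ys) with y ≟ g
    ... | yes _ = m≤m+n (d x y) _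
    ... | no _  = +-monoʳ-≤ (d x y) (costUntil≤walkCost y ys)

    costUntil-++ : ∀ x xs ys → g ∈ xs → costUntil d g x (xs ++ ys) ≡ costUntil d g x xs
    costUntil-++ x (y ∷ xs) ys g∈ with y ≟ g | g∈
    ... | yes _  | _          = refl
    ... | no y≢g | here g≡y   = ⊥-elim (y≢g (sym g≡y))
    ... | no _   | there g∈xs = cong (d x y +_) (costUntil-++ y xs ys g∈xs)

    costToGoal≤walkCost : ∀ r xs → costToGoal d g r xs ≤ walkCost d r xs
    costToGoal≤walkCost r xs with r ≟ g
    ... | yes _ = z≤n
    ... | no _  = costUntil≤walkCost r xs

    costToGoal-++ : ∀ r xs ys → g ∈ xs → costToGoal d g r (xs ++ ys) ≡ costToGoal d g r xs
    costToGoal-++ r xs ys g∈ with r ≟ g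
    ... | yes _ = refl
    ... | no _  = costUntil-++ r xs ys g∈

-- Cost of the planning algorithm

private
  round-arith : ∀ a b t c m → a ≤ b + m → t ≤ 2 * m → c ≤ m → (a + t) + c ≤ b + 4 * m
  round-arith a b t c m a≤ t≤ c≤ = begin
    (a + t) + c               ≤⟨ +-mono-≤ (+-mono-≤ a≤ t≤) c≤ ⟩
    ((b + m) + 2 * m) + m     ≡⟨ solve (b ∷ m ∷ []) ⟩
    b + 4 * m                 ∎
    where open ≤-Reasoning

module Planning {n} {E : List (Edge n)} {d : Fin n → Fin n → ℕ} {f : Fin n → ℤ} {plans : ℕ → List (Fin n)}
                (isSP : IsShortestPathMetric E d) (valid : ∀ ρ → ValidRound E d f ρ (plans ρ))
                (r g : Fin n) where
  open ShortestPathMetric isSP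

  roundMass : ℕ → ℕ
  roundMass ρ = ∑ (λ v → select (InS? d f ρ v) (d g v))

  massBefore : ℕ → ℕ
  massBefore zero    = 0
  massBefore (suc ρ) = massBefore ρ + roundMass ρ

  round-cost : ∀ ρ x → walkCost d x (plans ρ) + d (lastOr x (plans ρ)) g ≤ d x g + 4 * roundMass ρ
  round-cost ρ x with any? (InS? d f ρ)
  ... | no ∄ rewrite proj₁ (valid ρ) ∄ = m≤m+n (d x g) _
  ... | yes ∃v with proj₂ (valid ρ) ∃v
  ... | C , rρ , tour , minC , rρ∈S , plan≡ , last≡ , _ , tour≤ rewrite plan≡ | lastOr-last rρ tour last≡ =
    round-arith (d x rρ) (d x g) (walkCost d rρ tour) (d rρ g) (roundMass ρ)
      (≤-trans (d-triangle x g rρ) (+-monoʳ-≤ (d x g) dgrρ≤))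
      (≤-trans tour≤ (*-monoʳ-≤ 2 (minSteinerTree≤star (InS? d f ρ) g minC)))
      (subst (_≤ roundMass ρ) (d-sym g rρ) dgrρ≤)
    where
    dgrρ≤ : d g rρ ≤ roundMass ρ
    dgrρ≤ = ≤∑-select (InS? d f ρ) (d g) rρ∈S

  trajectory-cost : ∀ K → walkCost d r (trajectory plans K) + d (lastOr r (trajectory plans K)) g
                          ≤ d r g + 4 * massBefore K
  trajectory-cost zero = ≤-reflexive (sym (+-identityʳ (d r g)))
  trajectory-cost (suc K)
    rewrite trajectory-suc plans K
          | walkCost-++ d r (trajectory plans K) (plans K)
          | lastOr-++ r (trajectory plans K) (plans K) = begin
      (W + walkCost d x (plans K)) + d (lastOr x (plans K)) g ≡⟨ +-assoc W _ _ ⟩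
      W + (walkCost d x (plans K) + d (lastOr x (plans K)) g) ≤⟨ +-monoʳ-≤ W (round-cost K x) ⟩
      W + (d x g + 4 * roundMass K)                          ≡⟨ +-assoc W _ _ ⟨
      (W + d x g) + 4 * roundMass K                          ≤⟨ +-monoˡ-≤ _ (trajectory-cost K) ⟩
      (d r g + 4 * massBefore K) + 4 * roundMass K           ≡⟨ +-assoc (d r g) _ _ ⟩
      d r g + (4 * massBefore K + 4 * roundMass K)           ≡⟨ cong (d r g +_) (*-distribˡ-+ 4 (massBefore K) _) ⟨
      d r g + 4 * (massBefore K + roundMass K)               ∎
    where
    open ≤-Reasoning
    W = walkCost d r (trajectory plans K)
    x = lastOr r (trajectory plans K)

  massBefore≤ : ∀ K → massBefore K ≤ ∑ (λ v → select (InUnion? d f K v) (d g v))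
  massBefore≤ zero    = z≤n
  massBefore≤ (suc K) = begin
    massBefore K + roundMass K
      ≤⟨ +-monoˡ-≤ _ (massBefore≤ K) ⟩
    ∑ (λ v → select (InUnion? d f K v) (d g v)) + roundMass K
      ≡⟨ sum-map-+ _ _ (allFin n) ⟨
    ∑ (λ v → select (InUnion? d f K v) (d g v) + select (InS? d f K v) (d g v))
      ≤⟨ ∑-mono (λ v → select-disjoint-+ (InUnion? d f K v) (InS? d f K v) (InUnion? d f (suc K) v)
                                         inj₁ inj₂ proj₂) ⟩
    ∑ (λ v → select (InUnion? d f (suc K) v) (d g v))
      ∎
    where open ≤-Reasoning

  InUnion⇒∈trajectory : ∀ K → InUnion d f K g → g ∈ trajectory plans K
  InUnion⇒∈trajectory (suc K) g∈ rewrite trajectory-suc plans K with g∈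
  ... | inj₁ g∈U = ∈-++⁺ˡ (InUnion⇒∈trajectory K g∈U)
  ... | inj₂ g∈S with proj₂ (valid K) (g , g∈S)
  ... | _ , _ , _ , _ , _ , plan≡ , _ , visits , _ =
    ∈-++⁺ʳ (trajectory plans K) (subst (g ∈_) (sym plan≡) (visits g (inj₁ g∈S)))

  cost-bound : ∀ K → costToGoal d g r (trajectory plans K)
                     ≤ d r g + 4 * ∑ (λ v → select (φ₁ d f v ≤? 2 * φ₁ d f g) (d g v))
  cost-bound zero = ≤-trans (costToGoal≤walkCost d g r []) z≤n
  cost-bound (suc K) with InUnion? d f K g
  ... | yes g∈ = begin
    costToGoal d g r (trajectory plans (suc K))      ≡⟨ cong (costToGoal d g r) (trajectory-suc plans K) ⟩
    costToGoal d g r (trajectory plans K ++ plans K) ≡⟨ costToGoal-++ d g r _ _ (InUnion⇒∈trajectory K g∈) ⟩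
    costToGoal d g r (trajectory plans K)            ≤⟨ cost-bound K ⟩
    d r g + 4 * ∑ (λ v → select (φ₁ d f v ≤? 2 * φ₁ d f g) (d g v)) ∎
    where open ≤-Reasoning
  ... | no g∉ = begin
    costToGoal d g r (trajectory plans (suc K))  ≤⟨ costToGoal≤walkCost d g r _ ⟩
    walkCost d r (trajectory plans (suc K))      ≤⟨ m≤m+n _ _ ⟩
    walkCost d r (trajectory plans (suc K)) + _  ≤⟨ trajectory-cost (suc K) ⟩
    d r g + 4 * massBefore (suc K)               ≤⟨ +-monoʳ-≤ (d r g) (*-monoʳ-≤ 4 (massBefore≤ (suc K))) ⟩
    d r g + 4 * ∑ (λ v → select (InUnion? d f (suc K) v) (d g v))
      ≤⟨ +-monoʳ-≤ (d r g) (*-monoʳ-≤ 4 (∑-mono visited≤)) ⟩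
    d r g + 4 * ∑ (λ v → select (φ₁ d f v ≤? 2 * φ₁ d f g) (d g v)) ∎
    where
    open ≤-Reasoning
    visited≤ : ∀ v → select (InUnion? d f (suc K) v) (d g v) ≤ select (φ₁ d f v ≤? 2 * φ₁ d f g) (d g v)
    visited≤ v = select-mono (InUnion? d f (suc K) v) (φ₁ d f v ≤? 2 * φ₁ d f g)
                             (InUnion-suc⇒φ₁≤2*φ₁ d f K g∉)

doublingConstant-positive : ∀ {n} {d : Fin n → Fin n → ℕ} {λ′} →
                            (∀ u → d u u ≡ 0) → Fin n → DoublingCover d λ′ → 1 ≤ λ′
doublingConstant-positive d-refl v cover with cover v 0
... | cs , length≤λ′ , covers with covers v (≤-reflexive (d-refl v))
... | c , c∈cs , _ = ≤-trans (nonempty c∈cs) length≤λ′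
  where
  nonempty : ∀ {c cs} → c ∈ cs → 1 ≤ length cs
  nonempty {cs = _ ∷ _} _ = s≤s z≤n

constant-bound : ∀ {λ′} φ → 1 ≤ λ′ → 4 * (3 * φ + λ′ ^ 5 * (8 * (3 * φ))) ≤ λ′ ^ 108 * (108 * φ)
constant-bound {λ′} φ 1≤λ′ = scaled (λ′ ^ 5) (λ′ ^ 108) (m^n>0 λ′ 5) (^-monoʳ-≤ λ′ (m≤m+n 5 103))
  where
  instance
    λ′≢0 : NonZero λ′
    λ′≢0 = >-nonZero 1≤λ′

  scaled : ∀ L L′ → 1 ≤ L → L ≤ L′ → 4 * (3 * φ + L * (8 * (3 * φ))) ≤ L′ * (108 * φ)
  scaled L L′ 1≤L L≤L′ = begin
    4 * (3 * φ + L * (8 * (3 * φ)))   ≡⟨ solve (φ ∷ L ∷ []) ⟩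
    12 * (1 * φ) + 96 * (L * φ)       ≤⟨ +-monoˡ-≤ (96 * (L * φ)) (*-monoʳ-≤ 12 (*-monoˡ-≤ φ 1≤L)) ⟩
    12 * (L * φ) + 96 * (L * φ)       ≡⟨ solve (φ ∷ L ∷ []) ⟩
    L * (108 * φ)                     ≤⟨ *-monoˡ-≤ (108 * φ) L≤L′ ⟩
    L′ * (108 * φ)                    ∎
    where open ≤-Reasoning

lowError-totalDistance≤ : ∀ {n} {E : List (Edge n)} {d : Fin n → Fin n → ℕ} {λ′} (f : Fin n → ℤ) →
                          IsShortestPathMetric E d → DoublingCover d λ′ → ∀ g →
                          ∑ (λ v → select (φ₁ d f v ≤? 2 * φ₁ d f g) (d g v))
                            ≤ 3 * φ₁ d f g + λ′ ^ 5 * (8 * (3 * φ₁ d f g))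
lowError-totalDistance≤ {d = d} f isSP cover g =
  totalDistance≤ d-sym d-triangle cover g (λ v → φ₁ d f v ≤? 2 * φ₁ d f g) (3 * φ₁ d f g)
    λ v φ₁v≤ → ≤-trans (deviation≤φ₁+φ₁ d f g v) (+-monoʳ-≤ (φ₁ d f g) φ₁v≤)
  where open ShortestPathMetric isSP

mainTheorem4 : ∃[ c ] ∀ (n : ℕ) (E : List (Edge n)) (d : Fin n → Fin n → ℕ) (λ′ : ℕ)
                 (r g : Fin n) (f : Fin n → ℤ) (plans : ℕ → List (Fin n)) →
                 PositiveLengths E →
                 IsShortestPathMetric E d →
                 IsDoublingConstant d λ′ →
                 (∀ ρ → ValidRound E d f ρ (plans ρ)) →
                 ∀ K → costToGoal d g r (trajectory plans K)
                         ≤ d r g + λ′ ^ c * (c * φ₁ d f g)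
mainTheorem4 = 108 , λ n E d λ′ r g f plans _ isSP (cover , _) valid K → begin
  costToGoal d g r (trajectory plans K)
    ≤⟨ Planning.cost-bound isSP valid r g K ⟩
  d r g + 4 * ∑ (λ v → select (φ₁ d f v ≤? 2 * φ₁ d f g) (d g v))
    ≤⟨ +-monoʳ-≤ (d r g) (*-monoʳ-≤ 4 (lowError-totalDistance≤ f isSP cover g)) ⟩
  d r g + 4 * (3 * φ₁ d f g + λ′ ^ 5 * (8 * (3 * φ₁ d f g)))
    ≤⟨ +-monoʳ-≤ (d r g) (constant-bound (φ₁ d f g)
         (doublingConstant-positive (ShortestPathMetric.d-refl isSP) g cover)) ⟩
  d r g + λ′ ^ 108 * (108 * φ₁ d f g)
    ∎
  where open ≤-Reasoning
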